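{- An injective etale $B$-map $\mathsf H'\to\mathsf H$ of well-founded forward $B$-hypergraphs preserves the earliest-start-time function, i.e. $f_{\mathsf H}(y)=f_{\mathsf H'}(y)$ for every node $y$ of $\mathsf H'$.
   Context: A hypergraph is a diagram of sets $A\leftarrow I\to N\leftarrow O\to A$ with both spans relations and $I\to N$, $O\to N$ finite maps; morphisms are maps on the four sets commuting with the structure (same map on both copies of $A$), etale if the two middle squares are pullbacks. Forward: $O\to A$ injective. For a finite set $B$, a $B$-hypergraph is a forward hypergraph with $B$ identified bijectively with its in-boundary (complement of the image of $O\to A$); $B$-maps are etale maps compatible with the maps from $B$. Write $x\lessdot y$ if some hyperedge is $O$-related to $x$ and $I$-related to $y$; well-founded means the transitive closure $<$ is irreflexive and each $\{x\mid x\le y\}$ is finite. The earliest-start-time function $f:N\to\mathbb N$ is defined by $f(y)=1$ if there is no $x\lessdot y$, and $f(y)=1+\max\{f(x)\mid x\lessdot y\}$ otherwise (the length of the longest chain ending at $y$, plus one). -}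

module Defs where

open import Data.Nat using (ℕ; zero; suc; _≤_)
open import Data.List using (List)
open import Data.List.Membership.Propositional using (_∈_)
open import Data.Product using (Σ; Σ-syntax; _×_; _,_)
open import Data.Sum using (_⊎_)
open import Relation.Nullary using (¬_)
open import Relation.Binary.PropositionalEquality using (_≡_)
open import Relation.Binary.Construct.Closure.Transitive using (TransClosure)

FinitePred : {X : Set} → (X → Set) → Set
FinitePred {X} P = Σ (List X) λ L → ∀ x → (P x → x ∈ L) × (x ∈ L → P x)

-- A hypergraph  A ← I → N ← O → A  with both spans relations (jointly
-- injective) and I → N, O → N finite maps (finite fibres).
record Hypergraph : Set₁ where
  field
    A I N O : Set
    iA : I → A
    iN : I → N
    oN : O → N
    oA : O → A
    iRel : ∀ i j → iA i ≡ iA j → iN i ≡ iN j → i ≡ j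
    oRel : ∀ o p → oA o ≡ oA p → oN o ≡ oN p → o ≡ p
    iFin : ∀ n → FinitePred (λ i → iN i ≡ n)
    oFin : ∀ n → FinitePred (λ o → oN o ≡ n)

open Hypergraph public

_⊢_⋖_ : (H : Hypergraph) → N H → N H → Set
H ⊢ x ⋖ y = Σ[ a ∈ A H ] (Σ[ o ∈ O H ] (oN H o ≡ x × oA H o ≡ a))
                        × (Σ[ i ∈ I H ] (iN H i ≡ y × iA H i ≡ a))

_⊢_≺_ : (H : Hypergraph) → N H → N H → Set
H ⊢ x ≺ y = TransClosure (λ u v → H ⊢ u ⋖ v) x y

WellFoundedHG : Hypergraph → Set
WellFoundedHG H = (∀ x → ¬ (H ⊢ x ≺ x))
                × (∀ y → FinitePred (λ x → (H ⊢ x ≺ y) ⊎ (x ≡ y)))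

Forward : Hypergraph → Set
Forward H = ∀ o p → oA H o ≡ oA H p → o ≡ p

InBoundary : (H : Hypergraph) → A H → Set
InBoundary H a = ¬ (Σ[ o ∈ O H ] oA H o ≡ a)

record BHypergraph (B : Set) : Set₁ where
  field
    hg : Hypergraph
    forward : Forward hg
    β : B → A hg
    β-inj : ∀ b c → β b ≡ β c → b ≡ c
    β-in : ∀ b → InBoundary hg (β b)
    β-onto : ∀ a → InBoundary hg a → Σ[ b ∈ B ] β b ≡ a

open BHypergraph public

record HMorphism (H' H : Hypergraph) : Set where
  field
    fA : A H' → A H
    fI : I H' → I H
    fN : N H' → N H
    fO : O H' → O H
    comm-iA : ∀ i → iA H (fI i) ≡ fA (iA H' i)
    comm-iN : ∀ i → iN H (fI i) ≡ fN (iN H' i)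
    comm-oN : ∀ o → oN H (fO o) ≡ fN (oN H' o)
    comm-oA : ∀ o → oA H (fO o) ≡ fA (oA H' o)

open HMorphism public

-- etale: the two middle squares (I→N and O→N) are pullbacks
IsEtale : {H' H : Hypergraph} → HMorphism H' H → Set
IsEtale {H'} {H} φ =
    (∀ n i → iN H i ≡ fN φ n → Σ[ i' ∈ I H' ] (iN H' i' ≡ n × fI φ i' ≡ i))
  × (∀ i j → iN H' i ≡ iN H' j → fI φ i ≡ fI φ j → i ≡ j)
  × (∀ n o → oN H o ≡ fN φ n → Σ[ o' ∈ O H' ] (oN H' o' ≡ n × fO φ o' ≡ o))
  × (∀ o p → oN H' o ≡ oN H' p → fO φ o ≡ fO φ p → o ≡ p)

IsBMap : {B : Set} (G' G : BHypergraph B) → HMorphism (hg G') (hg G) → Set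
IsBMap {B} G' G φ = IsEtale φ × (∀ b → fA φ (β G' b) ≡ β G b)

Injective : {X Y : Set} → (X → Y) → Set
Injective f = ∀ x y → f x ≡ f y → x ≡ y

IsInjective : {H' H : Hypergraph} → HMorphism H' H → Set
IsInjective φ = Injective (fA φ) × Injective (fI φ) × Injective (fN φ) × Injective (fO φ)

IsMaxPred : (H : Hypergraph) → (N H → ℕ) → N H → ℕ → Set
IsMaxPred H f y m = (Σ[ x ∈ N H ] (H ⊢ x ⋖ y × f x ≡ m))
                  × (∀ x → H ⊢ x ⋖ y → f x ≤ m)

IsEarliestStartTime : (H : Hypergraph) → (N H → ℕ) → Set
IsEarliestStartTime H f = ∀ y →
    (¬ (Σ[ x ∈ N H ] H ⊢ x ⋖ y) → f y ≡ 1)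
  × ((Σ[ x ∈ N H ] H ⊢ x ⋖ y) → Σ[ m ∈ ℕ ] (IsMaxPred H f y m × f y ≡ suc m))

module Submission where

open import Defs
open import Data.Nat using (ℕ; suc; _≤_; _<_; s≤s)
open import Data.Nat.Properties using (_≟_; _≤?_; ≤-antisym)
open import Data.Nat.Induction using (<-wellFounded)
open import Data.Fin using (Fin)
open import Data.Product using (Σ-syntax; _×_; _,_; proj₁; proj₂)
open import Function.Bundles using (_↔_)
open import Induction.WellFounded using (module All)
open import Relation.Binary.Construct.On as On using ()
open import Relation.Nullary using (¬_; Dec; yes; no)
open import Relation.Nullary.Decidable using (decidable-stable; ¬¬-excluded-middle)
open import Relation.Nullary.Negation using (¬¬-map)
open import Relation.Binary.PropositionalEquality
  using (_≡_; refl; sym; trans; cong; subst; module ≡-Reasoning)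

-- Induct on f' y.  The predecessors of the image of y are exactly the images
-- of the predecessors of y: an input hyperedge of the image lifts to one of y
-- by etaleness, the lift is not in the in-boundary because B-maps send
-- in-boundary to in-boundary, and forwardness of the target identifies the
-- output nodes.  So both recursions take the same maximum.

⋖-map : {H' H : Hypergraph} (φ : HMorphism H' H) {x y : N H'} →
        H' ⊢ x ⋖ y → H ⊢ fN φ x ⋖ fN φ y
⋖-map φ (a , (o , ox , oa) , (i , iy , ia)) =
  fA φ a , (fO φ o , trans (comm-oN φ o) (cong (fN φ) ox) , trans (comm-oA φ o) (cong (fA φ) oa))
         , (fI φ i , trans (comm-iN φ i) (cong (fN φ) iy) , trans (comm-iA φ i) (cong (fA φ) ia))

-- Double negation because membership in the in-boundary is not decidable.
LiftsPredecessors : (H' H : Hypergraph) → (N H' → N H) → Set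
LiftsPredecessors H' H h =
  ∀ {x y} → H ⊢ x ⋖ h y → ¬ ¬ (Σ[ x' ∈ N H' ] (H' ⊢ x' ⋖ y × h x' ≡ x))

module _ {B : Set} (G' G : BHypergraph B) (φ : HMorphism (hg G') (hg G))
         (bMap : IsBMap G' G φ) where

  bMap-preserves-inBoundary : ∀ a → InBoundary (hg G') a → InBoundary (hg G) (fA φ a)
  bMap-preserves-inBoundary a a∈∂ with β-onto G' a a∈∂
  ... | b , refl = subst (InBoundary (hg G)) (sym (proj₂ bMap b)) (β-in G b)

  bMap-liftsPredecessors : LiftsPredecessors (hg G') (hg G) (fN φ)
  bMap-liftsPredecessors {x} {y} (a , (o , ox , oa) , (i , iy , ia)) ¬lift
    with proj₁ (proj₁ bMap) y i iy
  ... | i' , i'y , refl = notInBoundary λ { (o' , o'a') → ¬lift (lift o' o'a') }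
    where
    fA-a' : fA φ (iA (hg G') i') ≡ a
    fA-a' = trans (sym (comm-iA φ i')) ia

    notInBoundary : ¬ InBoundary (hg G') (iA (hg G') i')
    notInBoundary a'∈∂ =
      bMap-preserves-inBoundary _ a'∈∂ (o , trans oa (sym fA-a'))

    lift : (o' : O (hg G')) → oA (hg G') o' ≡ iA (hg G') i' →
           Σ[ x' ∈ N (hg G') ] (hg G' ⊢ x' ⋖ y × fN φ x' ≡ x)
    lift o' o'a' = oN (hg G') o' , (_ , (o' , refl , o'a') , (i' , i'y , refl)) , fN-x'
      where
      fO-o' : fO φ o' ≡ o
      fO-o' = forward G _ _ (trans (comm-oA φ o') (trans (cong (fA φ) o'a') (trans fA-a' (sym oa))))

      fN-x' : fN φ (oN (hg G') o') ≡ x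
      fN-x' = trans (sym (comm-oN φ o')) (trans (cong (oN (hg G)) fO-o') ox)

module _ {H : Hypergraph} {f : N H → ℕ} (est : IsEarliestStartTime H f) where

  earliestStartTime-⋖⇒< : ∀ {x y} → H ⊢ x ⋖ y → f x < f y
  earliestStartTime-⋖⇒< {x} {y} x⋖y with proj₂ (est y) (x , x⋖y)
  ... | m , (_ , bound) , fy≡ = subst (f x <_) (sym fy≡) (s≤s (bound x x⋖y))

module _ {H' H : Hypergraph} (h : N H' → N H)
         (preserves : ∀ {x y} → H' ⊢ x ⋖ y → H ⊢ h x ⋖ h y)
         (lifts : LiftsPredecessors H' H h)
         {f' : N H' → ℕ} {f : N H → ℕ} where

  isMaxPred-transfer : ∀ {y m' m} → (∀ x → H' ⊢ x ⋖ y → f (h x) ≡ f' x) →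
                       IsMaxPred H' f' y m' → IsMaxPred H f (h y) m → m ≡ m'
  isMaxPred-transfer {y} {m'} {m} agree ((x' , x'⋖y , fx'≡) , bound') ((x , x⋖hy , fx≡) , bound) =
    ≤-antisym m≤m' m'≤m
    where
    m'≤m : m' ≤ m
    m'≤m = subst (_≤ m) (trans (agree x' x'⋖y) fx'≡) (bound (h x') (preserves x'⋖y))

    m≤m' : m ≤ m'
    m≤m' = decidable-stable (m ≤? m') (¬¬-map fromLift (lifts x⋖hy))
      where
      fromLift : Σ[ z ∈ N H' ] (H' ⊢ z ⋖ y × h z ≡ x) → m ≤ m'
      fromLift (z , z⋖y , refl) = subst (_≤ m') (trans (sym (agree z z⋖y)) fx≡) (bound' z z⋖y)

  earliestStartTime-transfer : IsEarliestStartTime H' f' → IsEarliestStartTime H f →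
                               ∀ y → f (h y) ≡ f' y
  earliestStartTime-transfer est' est =
    All.wfRec (On.wellFounded f' <-wellFounded) _ (λ y → f (h y) ≡ f' y) step
    where
    step : ∀ y → (∀ {x} → f' x < f' y → f (h x) ≡ f' x) → f (h y) ≡ f' y
    step y ih = decidable-stable (f (h y) ≟ f' y) (¬¬-map byCases ¬¬-excluded-middle)
      where
      byCases : Dec (Σ[ x ∈ N H' ] H' ⊢ x ⋖ y) → f (h y) ≡ f' y
      byCases (no noPred) =
        trans (proj₁ (est (h y)) noPredImage) (sym (proj₁ (est' y) noPred))
        where
        noPredImage : ¬ (Σ[ x ∈ N H ] H ⊢ x ⋖ h y)
        noPredImage (_ , x⋖hy) = lifts x⋖hy λ { (z , z⋖y , _) → noPred (z , z⋖y) }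
      byCases (yes (x , x⋖y))
        with proj₂ (est' y) (x , x⋖y) | proj₂ (est (h y)) (h x , preserves x⋖y)
      ... | m' , max' , fy'≡ | m , max , fy≡ = begin
        f (h y)  ≡⟨ fy≡ ⟩
        suc m    ≡⟨ cong suc (isMaxPred-transfer agree max' max) ⟩
        suc m'   ≡⟨ sym fy'≡ ⟩
        f' y     ∎
        where
        open ≡-Reasoning
        agree : ∀ z → H' ⊢ z ⋖ y → f (h z) ≡ f' z
        agree z z⋖y = ih (earliestStartTime-⋖⇒< {H'} {f'} est' z⋖y)

corollary8p11 : (B : Set) (k : ℕ) → B ↔ Fin k →
    (G' G : BHypergraph B) →
    WellFoundedHG (hg G') → WellFoundedHG (hg G) →
    (φ : HMorphism (hg G') (hg G)) → IsBMap G' G φ → IsInjective φ →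
    (f' : N (hg G') → ℕ) (f : N (hg G) → ℕ) →
    IsEarliestStartTime (hg G') f' → IsEarliestStartTime (hg G) f →
    ∀ y → f (fN φ y) ≡ f' y
corollary8p11 B k _ G' G _ _ φ bMap _ f' f est' est =
  earliestStartTime-transfer {hg G'} {hg G} (fN φ) (⋖-map φ)
    (bMap-liftsPredecessors G' G φ bMap) {f'} {f} est' est
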